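{- Let $\mathcal{M}$ be a $2$-rigidity family and let $C$ be an $\mathcal{M}$-circuit that is not an $\mathcal{R}$-circuit. Then $C$ is $\mathcal{R}$-independent; in particular $|C|\le 2v(C)-3$ and $C$ contains at least six vertices of degree $3$.
   Context: Graphs are identified with their edge sets; $|C|$ is the number of edges, $v(C)$ the number of vertices. $\mathcal{R}$-independence: $G$ is $\mathcal{R}$-independent iff every set of $m\ge 2$ of its vertices induces at most $2m-3$ edges; $\mathcal{R}$-circuits are minimal $\mathcal{R}$-dependent graphs. A matroidal family is a sequence $(\mathcal{M}_n)_{n\ge2}$ of matroids on $\binom{[n]}{2}$, each invariant under vertex relabelling, such that a graph $\mathcal{M}_n$-independent for some $n$ is $\mathcal{M}_n$-independent for all $n\ge v(G)$; a $2$-rigidity family is one with each $\mathcal{M}_n$ of rank $2n-3$. -}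

module Defs where

open import Data.Bool using (Bool; true; false; _∧_; _∨_; not; if_then_else_)
open import Data.Nat using (ℕ; zero; suc; _+_; _*_; _∸_; _≤_; _<_; _≡ᵇ_; _<ᵇ_)
import Data.Nat.Properties as ℕP
open import Data.Fin using (Fin; toℕ; fromℕ<)
import Data.Fin as F
open import Data.Fin.Properties using (_<?_; _≟_)
open import Data.Fin.Permutation using (Permutation′; _⟨$⟩ˡ_)
open import Data.List using (List; []; _∷_; concatMap; allFin)
open import Data.Maybe using (Maybe; just; nothing)
open import Data.Product using (Σ; ∃; _×_; _,_)
open import Function.Bundles using (_⇔_)
open import Relation.Nullary using (¬_; yes; no; does)
open import Relation.Binary.PropositionalEquality using (_≡_)

-- Edges of the complete graph K_n on vertex set Fin n: unordered pairs
-- {i,j}, represented canonically as (i , j , i<j).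

Edge : ℕ → Set
Edge n = Σ (Fin n) λ i → Σ (Fin n) λ j → i F.< j

-- A graph on [n] is identified with its edge set, a subset of E(K_n).
EdgeSet : ℕ → Set
EdgeSet n = Edge n → Bool

allEdges : (n : ℕ) → List (Edge n)
allEdges n = concatMap (λ i → concatMap (λ j → pairs i j) (allFin n)) (allFin n)
  where
  pairs : Fin n → Fin n → List (Edge n)
  pairs i j with i <? j
  ... | yes p = (i , j , p) ∷ []
  ... | no _  = []

countL : {A : Set} → List A → (A → Bool) → ℕ
countL [] P = 0
countL (x ∷ xs) P = (if P x then 1 else 0) + countL xs P

size : {n : ℕ} → EdgeSet n → ℕ
size {n} G = countL (allEdges n) G

_≐_ : {n : ℕ} → EdgeSet n → EdgeSet n → Set
G ≐ H = ∀ e → G e ≡ H e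

_⊆_ : {n : ℕ} → EdgeSet n → EdgeSet n → Set
G ⊆ H = ∀ e → G e ≡ true → H e ≡ true

_⊂_ : {n : ℕ} → EdgeSet n → EdgeSet n → Set
G ⊂ H = G ⊆ H × ∃ λ e → H e ≡ true × G e ≡ false

∅ : {n : ℕ} → EdgeSet n
∅ _ = false

edgeEq : {n : ℕ} → Edge n → Edge n → Bool
edgeEq (i , j , _) (i′ , j′ , _) = does (i ≟ i′) ∧ does (j ≟ j′)

insert : {n : ℕ} → Edge n → EdgeSet n → EdgeSet n
insert e I e′ = I e′ ∨ edgeEq e′ e

-- is {a,b} an edge of G?  (false when a = b)
mem : {n : ℕ} → EdgeSet n → Fin n → Fin n → Bool
mem G a b with a <? b | b <? a
... | yes p | _     = G (a , b , p)
... | no _  | yes q = G (b , a , q)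
... | no _  | no _  = false

deg : {n : ℕ} → EdgeSet n → Fin n → ℕ
deg {n} G v = countL (allFin n) (mem G v)

-- v(G): number of (non-isolated) vertices of the graph G
nVerts : {n : ℕ} → EdgeSet n → ℕ
nVerts {n} G = countL (allFin n) (λ v → 0 <ᵇ deg G v)

nDeg3 : {n : ℕ} → EdgeSet n → ℕ
nDeg3 {n} G = countL (allFin n) (λ v → deg G v ≡ᵇ 3)

relabel : {n : ℕ} → Permutation′ n → EdgeSet n → EdgeSet n
relabel π G (i , j , _) = mem G (π ⟨$⟩ˡ i) (π ⟨$⟩ˡ j)

restrict : {n : ℕ} (m : ℕ) → Fin n → Maybe (Fin m)
restrict m i with toℕ i Data.Nat.<? m
... | yes p = just (fromℕ< p)
... | no _  = nothing

-- G ⊆ K_m viewed as a graph in K_n (vertices 0..m-1 kept)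
embed : {m n : ℕ} → EdgeSet m → EdgeSet n
embed {m} G (i , j , _) with restrict m i | restrict m j
... | just a | just b = mem G a b
... | _      | _      = false

record Matroid (n : ℕ) : Set₁ where
  field
    Indep      : EdgeSet n → Set
    indep-resp : ∀ {I J} → I ≐ J → Indep I → Indep J
    indep-∅    : Indep ∅
    indep-⊆    : ∀ {I J} → J ⊆ I → Indep I → Indep J
    augment    : ∀ {I J} → Indep I → Indep J → size I < size J →
                 ∃ λ e → J e ≡ true × I e ≡ false × Indep (insert e I)

open Matroid public

IsCircuit : {n : ℕ} → Matroid n → EdgeSet n → Set
IsCircuit M C = ¬ Indep M C × (∀ D → D ⊂ C → Indep M D)

-- 2-rigidity family.  M k is the matroid on E(K_{2+k}) (so n = 2 + k ≥ 2).
record RigidityFamily : Set₁ where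
  field
    M         : (k : ℕ) → Matroid (2 + k)
    relabel-inv : ∀ k (π : Permutation′ (2 + k)) (G : EdgeSet (2 + k)) →
                  Indep (M k) G → Indep (M k) (relabel π G)
    -- matroidal family: independence does not depend on the ambient K_n
    compat    : ∀ k l → k ≤ l → (G : EdgeSet (2 + k)) →
                Indep (M k) G ⇔ Indep (M l) (embed G)
    rank-attained : ∀ k → ∃ λ G → Indep (M k) G × size G ≡ 2 * (2 + k) ∸ 3
    rank-bound    : ∀ k G → Indep (M k) G → size G ≤ 2 * (2 + k) ∸ 3

open RigidityFamily public

-- R-independence (the generic 2-dimensional rigidity matroid)

VSet : ℕ → Set
VSet n = Fin n → Bool

vcount : {n : ℕ} → VSet n → ℕ
vcount {n} S = countL (allFin n) S

induced : {n : ℕ} → EdgeSet n → VSet n → ℕ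
induced {n} G S = countL (allEdges n) (λ { (i , j , p) → G (i , j , p) ∧ S i ∧ S j })

RIndep : {n : ℕ} → EdgeSet n → Set
RIndep G = ∀ S → 2 ≤ vcount S → induced G S + 3 ≤ 2 * vcount S

RCircuit : {n : ℕ} → EdgeSet n → Set
RCircuit C = ¬ RIndep C × (∀ D → D ⊂ C → RIndep D)

{-# OPTIONS --safe #-}
module Submission where

-- Every proper subgraph of an M-circuit C is M-independent, and M-independent graphs are
-- R-independent: a graph spanned by a vertex set S is, after relabelling the vertices outside S
-- away and using the compatibility of the family, independent in M_|S|, whose rank 2|S| - 3
-- bounds its size. So an R-dependent C would be an R-circuit; hence C is R-independent.
--
-- No vertex v of C has degree 1 or 2. Otherwise N(v) ⊆ {x, y}. Extend C - v to an independent
-- set B avoiding v of the maximal size 2n - 5 (the rank of M_(n-1)). Augmenting B twice from a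
-- base of M_n adds two edges v a₁, v a₂; relabelling a₁, a₂ to x, y gives an independent
-- B' + vx + vy with |B'| = |B|. Augmenting B from it twice can only add vx and then vy, since B
-- is maximal among independent sets avoiding v; so C ⊆ B + vx + vy would be independent.
-- Then each vertex contributes at least 4 to deg + [deg = 3], so 4 v(C) ≤ 2|C| + #deg₃,
-- while 2|C| + 6 ≤ 4 v(C).

open import Defs
open import Data.Bool using (Bool; true; false; _∧_; _∨_; not; if_then_else_)
import Data.Bool.Properties as 𝔹
open import Data.Empty using (⊥; ⊥-elim)
open import Data.Fin as Fin using (Fin; fromℕ; inject₁; punchIn; punchOut)
open import Data.Fin.Patterns using (0F; 1F)
import Data.Fin.Properties as FinP
open import Data.Fin.Properties using (_≟_; _<?_)
import Data.Fin.Permutation.Components as PC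
open import Data.Fin.Permutation using (Permutation′; _⟨$⟩ˡ_; flip; transpose; _∘ₚ_)
open import Data.Fin.Relation.Unary.Top using (view; ‵fromℕ; ‵inj₁)
open import Data.List using (List; []; _∷_; _++_; concatMap; allFin; tabulate)
open import Data.Maybe using (just; nothing)
open import Data.Nat using (ℕ; zero; suc; _+_; _*_; _∸_; _≤_; _<_; z≤n; s≤s; _<ᵇ_; _≡ᵇ_)
import Data.Nat.Properties as ℕP
open import Data.Product using (Σ; ∃; ∃₂; _×_; _,_; proj₁; proj₂)
open import Data.Sum using (_⊎_; inj₁; inj₂; [_,_]; [_,_]′)
open import Function using (_∘_; id)
open import Function.Bundles using (Equivalence)
open import Relation.Binary using (tri<; tri≈; tri>)
open import Relation.Binary.PropositionalEquality
  using (_≡_; _≢_; refl; sym; trans; cong; cong₂; subst; subst₂; module ≡-Reasoning)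
open import Relation.Nullary using (¬_; yes; no; does)
open import Relation.Nullary.Decidable using (dec-true; dec-false; ¬?; _×-dec_)
open import Algebra.Properties.CommutativeSemigroup ℕP.+-commutativeSemigroup using (interchange)
open import Algebra.Properties.Semiring.Sum ℕP.+-*-semiring
  using ( sum; sum-syntax; sum-cong-≗; sum-replicate-zero; sum-init-last; sum-permute
        ; ∑-comm; ∑-distrib-+; *-distribˡ-sum )

𝟙 : Bool → ℕ
𝟙 b = if b then 1 else 0

count : ∀ {n} → (Fin n → Bool) → ℕ
count {n} f = ∑[ i < n ] 𝟙 (f i)

𝟙≤1 : ∀ b → 𝟙 b ≤ 1
𝟙≤1 true  = ℕP.≤-refl
𝟙≤1 false = z≤n

sum-mono-≤ : ∀ {n} {f g : Fin n → ℕ} → (∀ i → f i ≤ g i) → sum f ≤ sum g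
sum-mono-≤ {zero}  _   = z≤n
sum-mono-≤ {suc n} f≤g = ℕP.+-mono-≤ (f≤g Fin.zero) (sum-mono-≤ (f≤g ∘ Fin.suc))

count≤n : ∀ {n} (f : Fin n → Bool) → count f ≤ n
count≤n {zero}  f = z≤n
count≤n {suc n} f = ℕP.+-mono-≤ (𝟙≤1 (f Fin.zero)) (count≤n (f ∘ Fin.suc))

count-all : ∀ n → count {n} (λ _ → true) ≡ n
count-all zero    = refl
count-all (suc n) = cong suc (count-all n)

count-pos : ∀ {n} (f : Fin n → Bool) → 0 < count f → ∃ λ i → f i ≡ true
count-pos {suc n} f pos with f Fin.zero in f0
... | true  = Fin.zero , f0
... | false with count-pos (f ∘ Fin.suc) pos
...   | i , fi = Fin.suc i , fi

δ : ∀ {n} → Fin n → Fin n → ℕ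
δ a i = 𝟙 (does (i ≟ a))

sum-δ : ∀ {n} (a : Fin n) → sum (δ a) ≡ 1
sum-δ {suc n} Fin.zero    = cong suc (sum-replicate-zero n)
sum-δ {suc n} (Fin.suc a) = sum-δ a

_∖_ : ∀ {n} → (Fin n → Bool) → Fin n → Fin n → Bool
(f ∖ a) i = f i ∧ not (does (i ≟ a))

count-∖ : ∀ {n} (f : Fin n → Bool) {a} → f a ≡ true → count f ≡ suc (count (f ∖ a))
count-∖ f {a} fa = begin
  count f                            ≡⟨ sum-cong-≗ split ⟩
  ∑[ i < _ ] (δ a i + 𝟙 ((f ∖ a) i)) ≡⟨ ∑-distrib-+ (δ a) (λ i → 𝟙 ((f ∖ a) i)) ⟩
  sum (δ a) + count (f ∖ a)          ≡⟨ cong (_+ count (f ∖ a)) (sum-δ a) ⟩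
  suc (count (f ∖ a))                ∎
  where
  open ≡-Reasoning
  split : ∀ i → 𝟙 (f i) ≡ 𝟙 (does (i ≟ a)) + 𝟙 (f i ∧ not (does (i ≟ a)))
  split i with i ≟ a
  ... | yes refl rewrite fa = refl
  ... | no _     = cong 𝟙 (sym (𝔹.∧-identityʳ (f i)))

∖-keeps : ∀ {n} (f : Fin n → Bool) {a b} → f b ≡ true → b ≢ a → (f ∖ a) b ≡ true
∖-keeps f fb b≢a = cong₂ (λ p q → p ∧ not q) fb (dec-false (_ ≟ _) b≢a)

count-≥-suc : ∀ {n} (f : Fin n → Bool) {a m} → f a ≡ true → m ≤ count (f ∖ a) →
              suc m ≤ count f
count-≥-suc f fa m≤ = subst (_ ≤_) (sym (count-∖ f fa)) (s≤s m≤)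

count≥1 : ∀ {n} (f : Fin n → Bool) {a} → f a ≡ true → 1 ≤ count f
count≥1 f fa = count-≥-suc f fa z≤n

count≥2 : ∀ {n} (f : Fin n → Bool) {a b} → a ≢ b → f a ≡ true → f b ≡ true → 2 ≤ count f
count≥2 f a≢b fa fb = count-≥-suc f fa (count≥1 (f ∖ _) (∖-keeps f fb (a≢b ∘ sym)))

count≥3 : ∀ {n} (f : Fin n → Bool) {a b c} → a ≢ b → a ≢ c → b ≢ c →
          f a ≡ true → f b ≡ true → f c ≡ true → 3 ≤ count f
count≥3 f a≢b a≢c b≢c fa fb fc =
  count-≥-suc f fa (count≥2 (f ∖ _) b≢c (∖-keeps f fb (a≢b ∘ sym)) (∖-keeps f fc (a≢c ∘ sym)))

transpose-matchˡ : ∀ {n} (i j : Fin n) → PC.transpose i j i ≡ j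
transpose-matchˡ i j rewrite dec-true (i ≟ i) refl = refl

transpose-matchʳ : ∀ {n} (i j : Fin n) → PC.transpose i j j ≡ i
transpose-matchʳ i j with j ≟ i
... | yes j≡i = j≡i
... | no _ rewrite dec-true (j ≟ j) refl = refl

transpose-other : ∀ {n} {i j k : Fin n} → k ≢ i → k ≢ j → PC.transpose i j k ≡ k
transpose-other {i = i} {j} {k} k≢i k≢j
  rewrite dec-false (k ≟ i) k≢i | dec-false (k ≟ j) k≢j = refl

transpose-injective : ∀ {n} (i j : Fin n) {a b} → PC.transpose i j a ≡ PC.transpose i j b → a ≡ b
transpose-injective i j {a} {b} eq = begin
  a                                     ≡⟨ sym (PC.transpose-inverse j i) ⟩
  PC.transpose j i (PC.transpose i j a) ≡⟨ cong (PC.transpose j i) eq ⟩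
  PC.transpose j i (PC.transpose i j b) ≡⟨ PC.transpose-inverse j i ⟩
  b                                     ∎
  where open ≡-Reasoning

toLast : ∀ {n} → Fin (suc n) → Permutation′ (suc n)
toLast {n} w = transpose w (fromℕ n)

toLast-last : ∀ {n} (w : Fin (suc n)) → toLast w ⟨$⟩ˡ fromℕ n ≡ w
toLast-last {n} w = transpose-matchˡ (fromℕ n) w

toLast-self : ∀ {n} (w : Fin (suc n)) → toLast w ⟨$⟩ˡ w ≡ fromℕ n
toLast-self {n} w = transpose-matchʳ (fromℕ n) w

permutation-fixing : ∀ {n} {v x y a b : Fin n} → x ≢ y → a ≢ b → x ≢ v → y ≢ v → a ≢ v → b ≢ v →
                     Σ (Permutation′ n) λ σ → σ ⟨$⟩ˡ v ≡ v × σ ⟨$⟩ˡ x ≡ a × σ ⟨$⟩ˡ y ≡ b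
permutation-fixing {v = v} {x} {y} {a} {b} x≢y a≢b x≢v y≢v a≢v b≢v =
  transpose b y′ ∘ₚ transpose a x , fixes-v , sends-x , transpose-matchˡ y′ b
  where
  y′ = PC.transpose x a y
  fixes-v′ : PC.transpose x a v ≡ v
  fixes-v′ = transpose-other (x≢v ∘ sym) (a≢v ∘ sym)
  y′≢a : y′ ≢ a
  y′≢a eq = x≢y (sym (transpose-injective x a (trans eq (sym (transpose-matchˡ x a)))))
  y′≢v : y′ ≢ v
  y′≢v eq = y≢v (transpose-injective x a (trans eq (sym fixes-v′)))
  fixes-v : PC.transpose y′ b (PC.transpose x a v) ≡ v
  fixes-v = trans (cong (PC.transpose y′ b) fixes-v′) (transpose-other (y′≢v ∘ sym) (b≢v ∘ sym))
  sends-x : PC.transpose y′ b (PC.transpose x a x) ≡ a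
  sends-x = trans (cong (PC.transpose y′ b) (transpose-matchˡ x a)) (transpose-other (y′≢a ∘ sym) a≢b)

count-missing : ∀ {n} (f : Fin (suc n) → Bool) {w} → f w ≡ false →
                count f ≡ count (λ a → f (toLast w ⟨$⟩ˡ inject₁ a))
count-missing {n} f {w} fw = begin
  count f                                     ≡⟨ sum-permute (𝟙 ∘ f) (flip τ) ⟩
  count (f ∘ (τ ⟨$⟩ˡ_))                        ≡⟨ sum-init-last (𝟙 ∘ f ∘ (τ ⟨$⟩ˡ_)) ⟩
  rest + 𝟙 (f (τ ⟨$⟩ˡ fromℕ n))                ≡⟨ cong (λ b → rest + 𝟙 (f b)) (toLast-last w) ⟩
  rest + 𝟙 (f w)                              ≡⟨ cong (λ b → rest + 𝟙 b) fw ⟩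
  rest + 0                                    ≡⟨ ℕP.+-identityʳ rest ⟩
  rest                                        ∎
  where
  open ≡-Reasoning
  τ = toLast w
  rest = count (f ∘ (τ ⟨$⟩ˡ_) ∘ inject₁)

countL-++ : ∀ {A : Set} (xs ys : List A) P → countL (xs ++ ys) P ≡ countL xs P + countL ys P
countL-++ []       ys P = refl
countL-++ (x ∷ xs) ys P =
  trans (cong (𝟙 (P x) +_) (countL-++ xs ys P)) (sym (ℕP.+-assoc (𝟙 (P x)) _ _))

countL-tabulate : ∀ {A : Set} {n} (f : Fin n → A) P →
                  countL (tabulate f) P ≡ ∑[ i < n ] 𝟙 (P (f i))
countL-tabulate {n = zero}  f P = refl
countL-tabulate {n = suc n} f P = cong (𝟙 (P (f Fin.zero)) +_) (countL-tabulate (f ∘ Fin.suc) P)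

countL-allFin : ∀ {n} (f : Fin n → Bool) → countL (allFin n) f ≡ count f
countL-allFin = countL-tabulate id

countL-concatMap : ∀ {A B : Set} {n} (f : A → List B) (g : Fin n → A) P →
                   countL (concatMap f (tabulate g)) P ≡ ∑[ i < n ] countL (f (g i)) P
countL-concatMap {n = zero}  f g P = refl
countL-concatMap {n = suc n} f g P =
  trans (countL-++ (f (g Fin.zero)) _ P)
        (cong (countL (f (g Fin.zero)) P +_) (countL-concatMap f (g ∘ Fin.suc) P))

countL-cong : ∀ {A : Set} (xs : List A) {P Q : A → Bool} → (∀ x → P x ≡ Q x) →
              countL xs P ≡ countL xs Q
countL-cong []       P≗Q = refl
countL-cong (x ∷ xs) P≗Q = cong₂ _+_ (cong 𝟙 (P≗Q x)) (countL-cong xs P≗Q)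

countL-∨ : ∀ {A : Set} (xs : List A) {P Q : A → Bool} → (∀ x → P x ≡ true → Q x ≡ false) →
           countL xs (λ x → P x ∨ Q x) ≡ countL xs P + countL xs Q
countL-∨ []       _    = refl
countL-∨ (x ∷ xs) {P} {Q} disj =
  trans (cong₂ _+_ (𝟙-∨ (P x) (disj x)) (countL-∨ xs disj)) (interchange (𝟙 (P x)) (𝟙 (Q x)) _ _)
  where
  𝟙-∨ : ∀ p → (p ≡ true → Q x ≡ false) → 𝟙 (p ∨ Q x) ≡ 𝟙 p + 𝟙 (Q x)
  𝟙-∨ true  disj-x rewrite disj-x refl = refl
  𝟙-∨ false _      = refl

-- allEdges is built from a helper local to Defs; this gives the helper a name.
edgeRows : ∀ n → Σ (Fin n → Fin n → List (Edge n)) λ pairs →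
           allEdges n ≡ concatMap (λ i → concatMap (pairs i) (allFin n)) (allFin n)
edgeRows n = _ , refl

ordAdj : ∀ {n} → EdgeSet n → Fin n → Fin n → ℕ
ordAdj G i j with i <? j
... | yes i<j = 𝟙 (G (i , j , i<j))
... | no _    = 0

countL-edgeRow : ∀ {n} (G : EdgeSet n) i j → countL (proj₁ (edgeRows n) i j) G ≡ ordAdj G i j
countL-edgeRow G i j with i <? j
... | yes _ = ℕP.+-identityʳ _
... | no _  = refl

size≡∑∑ordAdj : ∀ {n} (G : EdgeSet n) → size G ≡ ∑[ i < n ] ∑[ j < n ] ordAdj G i j
size≡∑∑ordAdj {n} G =
  trans (countL-concatMap (λ i → concatMap (row i) (allFin n)) id G)
        (sum-cong-≗ λ i → trans (countL-concatMap (row i) id G) (sum-cong-≗ (countL-edgeRow G i)))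
  where row = proj₁ (edgeRows n)

mem-edge : ∀ {n} (G : EdgeSet n) {i j} (i<j : i Fin.< j) → mem G i j ≡ G (i , j , i<j)
mem-edge G {i} {j} i<j with i <? j
... | yes i<j′ = cong (λ p → G (i , j , p)) (FinP.<-irrelevant i<j′ i<j)
... | no  i≮j  = ⊥-elim (i≮j i<j)

mem-sym : ∀ {n} (G : EdgeSet n) i j → mem G i j ≡ mem G j i
mem-sym G i j with i <? j | j <? i
... | yes i<j | yes j<i = ⊥-elim (FinP.<-asym i<j j<i)
... | yes _   | no _    = refl
... | no _    | yes _   = refl
... | no _    | no _    = refl

mem-irrefl : ∀ {n} (G : EdgeSet n) i → mem G i i ≡ false
mem-irrefl G i with i <? i
... | yes i<i = ⊥-elim (FinP.<-irrefl refl i<i)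
... | no _    = refl

mem-true-≢ : ∀ {n} (G : EdgeSet n) {i j} → mem G i j ≡ true → i ≢ j
mem-true-≢ G {i} Gij refl = 𝔹.not-¬ (mem-irrefl G i) Gij

mem-determined : ∀ {n} (G : EdgeSet n) (f : Fin n → Fin n → Bool) →
                 (∀ a b → f a b ≡ f b a) → (∀ a → f a a ≡ false) →
                 (∀ a b a<b → G (a , b , a<b) ≡ f a b) →
                 ∀ i j → mem G i j ≡ f i j
mem-determined G f f-sym f-irrefl G≡f i j with i <? j | j <? i
... | yes i<j | _       = G≡f i j i<j
... | no _    | yes j<i = trans (G≡f j i j<i) (f-sym j i)
... | no i≮j  | no j≮i with FinP.<-cmp i j
...   | tri< i<j _    _   = ⊥-elim (i≮j i<j)
...   | tri> _   _    j<i = ⊥-elim (j≮i j<i)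
...   | tri≈ _   refl _   = sym (f-irrefl i)

≐-from-mem : ∀ {n} {G H : EdgeSet n} → (∀ i j → mem G i j ≡ mem H i j) → G ≐ H
≐-from-mem {G = G} {H} G~H (i , j , i<j) =
  trans (sym (mem-edge G i<j)) (trans (G~H i j) (mem-edge H i<j))

𝟙mem≡ordAdj+ordAdj : ∀ {n} (G : EdgeSet n) i j → 𝟙 (mem G i j) ≡ ordAdj G i j + ordAdj G j i
𝟙mem≡ordAdj+ordAdj G i j with i <? j | j <? i
... | yes i<j | yes j<i = ⊥-elim (FinP.<-asym i<j j<i)
... | yes _   | no _    = sym (ℕP.+-identityʳ _)
... | no _    | yes _   = refl
... | no _    | no _    = refl

handshake : ∀ {n} (G : EdgeSet n) → ∑[ i < n ] ∑[ j < n ] 𝟙 (mem G i j) ≡ 2 * size G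
handshake {n} G = begin
  ∑[ i < n ] ∑[ j < n ] 𝟙 (mem G i j)
    ≡⟨ sum-cong-≗ (λ i → sum-cong-≗ (𝟙mem≡ordAdj+ordAdj G i)) ⟩
  ∑[ i < n ] ∑[ j < n ] (ordAdj G i j + ordAdj G j i)
    ≡⟨ sum-cong-≗ (λ i → ∑-distrib-+ (ordAdj G i) (λ j → ordAdj G j i)) ⟩
  ∑[ i < n ] (∑[ j < n ] ordAdj G i j + ∑[ j < n ] ordAdj G j i)
    ≡⟨ ∑-distrib-+ (λ i → ∑[ j < n ] ordAdj G i j) (λ i → ∑[ j < n ] ordAdj G j i) ⟩
  A + ∑[ i < n ] ∑[ j < n ] ordAdj G j i
    ≡⟨ cong (A +_) (∑-comm (λ j i → ordAdj G i j)) ⟩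
  A + A
    ≡⟨ cong (A +_) (sym (ℕP.+-identityʳ A)) ⟩
  2 * A
    ≡⟨ cong (2 *_) (sym (size≡∑∑ordAdj G)) ⟩
  2 * size G
    ∎
  where
  open ≡-Reasoning
  A = ∑[ i < n ] ∑[ j < n ] ordAdj G i j

size-cong-mem : ∀ {n} {G H : EdgeSet n} → (∀ i j → mem G i j ≡ mem H i j) → size G ≡ size H
size-cong-mem {G = G} {H} G~H = ℕP.*-cancelˡ-≡ _ _ 2 (begin
  2 * size G                          ≡⟨ sym (handshake G) ⟩
  ∑[ i < _ ] ∑[ j < _ ] 𝟙 (mem G i j) ≡⟨ sum-cong-≗ (λ i → sum-cong-≗ (cong 𝟙 ∘ G~H i)) ⟩
  ∑[ i < _ ] ∑[ j < _ ] 𝟙 (mem H i j) ≡⟨ handshake H ⟩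
  2 * size H                          ∎)
  where open ≡-Reasoning

size-cong : ∀ {n} {G H : EdgeSet n} → G ≐ H → size G ≡ size H
size-cong {n} = countL-cong (allEdges n)

∑deg≡2*size : ∀ {n} (G : EdgeSet n) → ∑[ v < n ] deg G v ≡ 2 * size G
∑deg≡2*size G = trans (sum-cong-≗ (λ v → countL-allFin (mem G v))) (handshake G)

data Joins {n} : Edge n → Fin n → Fin n → Set where
  forward  : ∀ {i j} (i<j : i Fin.< j) → Joins (i , j , i<j) i j
  backward : ∀ {i j} (i<j : i Fin.< j) → Joins (i , j , i<j) j i

edge-≡ : ∀ {n} {i j : Fin n} (p q : i Fin.< j) → _≡_ {A = Edge n} (i , j , p) (i , j , q)
edge-≡ {i = i} {j} p q = cong (λ r → (i , j , r)) (FinP.<-irrelevant p q)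

joins-mem : ∀ {n} (X : EdgeSet n) {e a b} → Joins e a b → mem X a b ≡ X e
joins-mem X (forward  i<j)         = mem-edge X i<j
joins-mem X (backward {i} {j} i<j) = trans (mem-sym X j i) (mem-edge X i<j)

joins-unique : ∀ {n} {e e′ : Edge n} {a b} → Joins e a b → Joins e′ a b → e ≡ e′
joins-unique (forward  p) (forward  q) = edge-≡ p q
joins-unique (backward p) (backward q) = edge-≡ p q
joins-unique (forward  p) (backward q) = ⊥-elim (FinP.<-asym p q)
joins-unique (backward p) (forward  q) = ⊥-elim (FinP.<-asym p q)

joins-other : ∀ {n} {e : Edge n} {v a b} → Joins e v a → Joins e v b → a ≡ b
joins-other (forward  _)   (forward  _) = refl
joins-other (backward _)   (backward _) = refl
joins-other (forward  i<j) (backward _) = ⊥-elim (FinP.<-irrefl refl i<j)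
joins-other (backward i<j) (forward  _) = ⊥-elim (FinP.<-irrefl refl i<j)

joins-≢ : ∀ {n} {e : Edge n} {a b} → Joins e a b → a ≢ b
joins-≢ (forward  i<j) refl = FinP.<-irrefl refl i<j
joins-≢ (backward i<j) refl = FinP.<-irrefl refl i<j

edgeBetween : ∀ {n} {a b : Fin n} → a ≢ b → Σ (Edge n) λ e → Joins e a b
edgeBetween {a = a} {b} a≢b with FinP.<-cmp a b
... | tri< a<b _ _ = (a , b , a<b) , forward a<b
... | tri≈ _ a≡b _ = ⊥-elim (a≢b a≡b)
... | tri> _ _ b<a = (b , a , b<a) , backward b<a

mem⇒edge : ∀ {n} (X : EdgeSet n) a b → mem X a b ≡ true →
           Σ (Edge n) λ e → X e ≡ true × Joins e a b
mem⇒edge X a b Xab with a <? b | b <? a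
... | yes a<b | _       = (a , b , a<b) , Xab , forward a<b
... | no _    | yes b<a = (b , a , b<a) , Xab , backward b<a

mem-mono : ∀ {n} {X Y : EdgeSet n} → X ⊆ Y → ∀ a b → mem X a b ≡ true → mem Y a b ≡ true
mem-mono {X = X} {Y} X⊆Y a b Xab with mem⇒edge X a b Xab
... | e , Xe , e-ab = trans (joins-mem Y e-ab) (X⊆Y e Xe)

⊆-false : ∀ {n} {X Y : EdgeSet n} → X ⊆ Y → ∀ {e} → Y e ≡ false → X e ≡ false
⊆-false X⊆Y {e} Ye = 𝔹.¬-not λ Xe → 𝔹.not-¬ Ye (X⊆Y e Xe)

single : ∀ {n} → Edge n → EdgeSet n
single e e′ = edgeEq e′ e

single-sound : ∀ {n} {e e′ : Edge n} → single e e′ ≡ true → e′ ≡ e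
single-sound {e = i′ , j′ , _} {e′ = i , j , _} eq with i ≟ i′ | j ≟ j′
... | yes refl | yes refl = edge-≡ _ _

single-refl : ∀ {n} (e : Edge n) → single e e ≡ true
single-refl (i , j , _) rewrite dec-true (i ≟ i) refl | dec-true (j ≟ j) refl = refl

ordAdj-single : ∀ {n} {i j : Fin n} (i<j : i Fin.< j) a b →
                ordAdj (single (i , j , i<j)) a b ≡ 𝟙 (does (a ≟ i) ∧ does (b ≟ j))
ordAdj-single {i = i} {j} i<j a b with a <? b
... | yes _   = refl
... | no a≮b with a ≟ i | b ≟ j
...   | yes refl | yes refl = ⊥-elim (a≮b i<j)
...   | yes _    | no _     = refl
...   | no _     | _        = refl

size-single : ∀ {n} (e : Edge n) → size (single e) ≡ 1
size-single {n} (i , j , i<j) = begin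
  size E                                                ≡⟨ size≡∑∑ordAdj E ⟩
  ∑[ a < n ] ∑[ b < n ] ordAdj E a b                    ≡⟨ sum-cong-≗ (sum-cong-≗ ∘ ordAdj-single i<j) ⟩
  ∑[ a < n ] ∑[ b < n ] 𝟙 (does (a ≟ i) ∧ does (b ≟ j)) ≡⟨ sum-cong-≗ row ⟩
  sum (δ i)                                             ≡⟨ sum-δ i ⟩
  1                                                     ∎
  where
  open ≡-Reasoning
  E = single (i , j , i<j)
  row : ∀ a → ∑[ b < n ] 𝟙 (does (a ≟ i) ∧ does (b ≟ j)) ≡ δ i a
  row a with a ≟ i
  ... | yes _ = sum-δ j
  ... | no _  = sum-replicate-zero n

size-insert : ∀ {n} (I : EdgeSet n) e → I e ≡ false → size (insert e I) ≡ suc (size I)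
size-insert {n} I e Ie = begin
  size (insert e I)        ≡⟨ countL-∨ (allEdges n) disjoint ⟩
  size I + size (single e) ≡⟨ cong (size I +_) (size-single e) ⟩
  size I + 1               ≡⟨ ℕP.+-comm (size I) 1 ⟩
  suc (size I)             ∎
  where
  open ≡-Reasoning
  disjoint : ∀ e′ → I e′ ≡ true → single e e′ ≡ false
  disjoint e′ Ie′ = 𝔹.¬-not λ e′≡e → 𝔹.not-¬ Ie (trans (cong I (sym (single-sound e′≡e))) Ie′)

insert-cases : ∀ {n} {I : EdgeSet n} {e e′} → insert e I e′ ≡ true → I e′ ≡ true ⊎ e′ ≡ e
insert-cases {I = I} {e} {e′} h with I e′
... | true  = inj₁ refl
... | false = inj₂ (single-sound h)

⊆-insert : ∀ {n} (I : EdgeSet n) e → I ⊆ insert e I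
⊆-insert I e e′ Ie′ rewrite Ie′ = refl

∈-insert : ∀ {n} (I : EdgeSet n) e → insert e I e ≡ true
∈-insert I e rewrite single-refl e = 𝔹.∨-zeroʳ (I e)

insert-⊆ : ∀ {n} {I Y : EdgeSet n} {e} → I ⊆ Y → Y e ≡ true → insert e I ⊆ Y
insert-⊆ {I = I} {e = e} I⊆Y Ye e′ h with insert-cases {I = I} {e} h
... | inj₁ Ie′  = I⊆Y e′ Ie′
... | inj₂ refl = Ye

insert-mono : ∀ {n} {I I′ : EdgeSet n} e → I ⊆ I′ → insert e I ⊆ insert e I′
insert-mono {I′ = I′} e I⊆I′ = insert-⊆ (λ e′ → ⊆-insert I′ e e′ ∘ I⊆I′ e′) (∈-insert I′ e)

∉-insert : ∀ {n} {I : EdgeSet n} {e e′} → I e′ ≡ false → e′ ≢ e → insert e I e′ ≡ false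
∉-insert {I = I} {e} Ie′ e′≢e =
  𝔹.¬-not λ h → [ 𝔹.not-¬ Ie′ , e′≢e ] (insert-cases {I = I} {e} h)

∧-true : ∀ {a b} → a ∧ b ≡ true → a ≡ true × b ≡ true
∧-true {true} {true} _ = refl , refl

Within : ∀ {n} → VSet n → EdgeSet n → Set
Within S G = ∀ i j → mem G i j ≡ true → S i ≡ true

infixl 30 _↾_

_↾_ : ∀ {n} → EdgeSet n → VSet n → EdgeSet n
(G ↾ S) (i , j , i<j) = G (i , j , i<j) ∧ (S i ∧ S j)

mem-↾ : ∀ {n} (G : EdgeSet n) S i j → mem (G ↾ S) i j ≡ mem G i j ∧ (S i ∧ S j)
mem-↾ G S = mem-determined (G ↾ S) (λ a b → mem G a b ∧ (S a ∧ S b))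
  (λ a b → cong₂ _∧_ (mem-sym G a b) (𝔹.∧-comm (S a) (S b)))
  (λ a → cong (_∧ (S a ∧ S a)) (mem-irrefl G a))
  (λ a b a<b → cong (_∧ (S a ∧ S b)) (sym (mem-edge G a<b)))

↾-⊆ : ∀ {n} (G : EdgeSet n) S → G ↾ S ⊆ G
↾-⊆ G S (i , j , i<j) h = proj₁ (∧-true h)

↾-within : ∀ {n} (G : EdgeSet n) S → Within S (G ↾ S)
↾-within G S i j h = proj₁ (∧-true (proj₂ (∧-true {mem G i j} (trans (sym (mem-↾ G S i j)) h))))

↾-within-size : ∀ {n} {S : VSet n} {G} → Within S G → size (G ↾ S) ≡ size G
↾-within-size {S = S} {G} G⊆S = size-cong-mem λ a b → trans (mem-↾ G S a b) (absorb a b)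
  where
  absorb : ∀ a b → mem G a b ∧ (S a ∧ S b) ≡ mem G a b
  absorb a b with mem G a b in Gab
  ... | false = refl
  ... | true  = cong₂ _∧_ (G⊆S a b Gab) (G⊆S b a (trans (mem-sym G b a) Gab))

within-edge : ∀ {n} {S : VSet n} {J} → Within S J → ∀ {i j} (i<j : i Fin.< j) →
              J (i , j , i<j) ≡ true → S i ≡ true × S j ≡ true
within-edge {J = J} J⊆S {i} {j} i<j Je =
  J⊆S i j (trans (mem-edge J i<j) Je) , J⊆S j i (trans (mem-sym J j i) (trans (mem-edge J i<j) Je))

within-insert : ∀ {n} {S : VSet n} {I} {i j} (i<j : i Fin.< j) →
                Within S I → S i ≡ true → S j ≡ true → Within S (insert (i , j , i<j) I)
within-insert {I = I} {i} {j} i<j I⊆S Si Sj a b h with mem⇒edge (insert (i , j , i<j) I) a b h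
... | e , h′ , e-ab with insert-cases {I = I} {i , j , i<j} h′ | e-ab
...   | inj₁ Ie   | _          = I⊆S a b (trans (joins-mem I e-ab) Ie)
...   | inj₂ refl | forward  _ = Si
...   | inj₂ refl | backward _ = Sj

others : ∀ {n} → Fin n → VSet n
others v = (λ _ → true) ∖ v

others-self : ∀ {n} (v : Fin n) → others v v ≡ false
others-self v = cong not (dec-true (v ≟ v) refl)

others-≢ : ∀ {n} {v i : Fin n} → others v i ≡ true → i ≢ v
others-≢ {v = v} h refl = 𝔹.not-¬ (others-self v) h

≢-others : ∀ {n} {v i : Fin n} → i ≢ v → others v i ≡ true
≢-others = ∖-keeps (λ _ → true) refl

count-others : ∀ {n} (v : Fin (suc n)) → count (others v) ≡ n
count-others {n} v =
  ℕP.suc-injective (trans (sym (count-∖ (λ _ → true) {v} refl)) (count-all (suc n)))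

within-others-joins : ∀ {n} {v a : Fin n} {X e} → Within (others v) X → Joins e v a → X e ≡ false
within-others-joins {v = v} {a} {X} X⊆ e-va =
  𝔹.¬-not λ Xe → 𝔹.not-¬ (others-self v) (X⊆ v a (trans (joins-mem X e-va) Xe))

↾-others-or-joins : ∀ {n} (C : EdgeSet n) (v : Fin n) e → C e ≡ true →
                    (C ↾ others v) e ≡ true ⊎ ∃ λ a → Joins e v a
↾-others-or-joins C v (i , j , i<j) Ce with i ≟ v | j ≟ v
... | yes refl | _        = inj₂ (j , forward i<j)
... | no _     | yes refl = inj₂ (i , backward i<j)
... | no _     | no _     = inj₁ (trans (𝔹.∧-identityʳ (C (i , j , i<j))) Ce)

mem-relabel : ∀ {n} (π : Permutation′ n) (G : EdgeSet n) i j →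
              mem (relabel π G) i j ≡ mem G (π ⟨$⟩ˡ i) (π ⟨$⟩ˡ j)
mem-relabel π G = mem-determined (relabel π G) (λ a b → mem G (π ⟨$⟩ˡ a) (π ⟨$⟩ˡ b))
  (λ a b → mem-sym G (π ⟨$⟩ˡ a) (π ⟨$⟩ˡ b)) (λ a → mem-irrefl G (π ⟨$⟩ˡ a)) (λ a b a<b → refl)

size-relabel : ∀ {n} (π : Permutation′ n) (G : EdgeSet n) → size (relabel π G) ≡ size G
size-relabel {n} π G = ℕP.*-cancelˡ-≡ _ _ 2 (begin
  2 * size (relabel π G)
    ≡⟨ sym (handshake (relabel π G)) ⟩
  ∑[ i < n ] ∑[ j < n ] 𝟙 (mem (relabel π G) i j)
    ≡⟨ sum-cong-≗ (λ i → sum-cong-≗ (cong 𝟙 ∘ mem-relabel π G i)) ⟩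
  ∑[ i < n ] ∑[ j < n ] 𝟙 (mem G (π ⟨$⟩ˡ i) (π ⟨$⟩ˡ j))
    ≡⟨ sum-cong-≗ (λ i → sym (sum-permute (λ j → 𝟙 (mem G (π ⟨$⟩ˡ i) j)) (flip π))) ⟩
  ∑[ i < n ] ∑[ j < n ] 𝟙 (mem G (π ⟨$⟩ˡ i) j)
    ≡⟨ sym (sum-permute (λ i → ∑[ j < n ] 𝟙 (mem G i j)) (flip π)) ⟩
  ∑[ i < n ] ∑[ j < n ] 𝟙 (mem G i j)
    ≡⟨ handshake G ⟩
  2 * size G
    ∎)
  where open ≡-Reasoning

relabel-joins : ∀ {n} (π : Permutation′ n) (X : EdgeSet n) {e a b} → Joins e a b →
                relabel π X e ≡ mem X (π ⟨$⟩ˡ a) (π ⟨$⟩ˡ b)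
relabel-joins π X {e} {a} {b} e-ab =
  trans (sym (joins-mem (relabel π X) {e} e-ab)) (mem-relabel π X a b)

relabel-mono : ∀ {n} (π : Permutation′ n) {X Y : EdgeSet n} → X ⊆ Y → relabel π X ⊆ relabel π Y
relabel-mono π X⊆Y (i , j , _) = mem-mono X⊆Y (π ⟨$⟩ˡ i) (π ⟨$⟩ˡ j)

within-relabel : ∀ {n} (π : Permutation′ n) {S : VSet n} {G} → Within S G →
                 Within (S ∘ (π ⟨$⟩ˡ_)) (relabel π G)
within-relabel π {G = G} G⊆S i j h =
  G⊆S (π ⟨$⟩ˡ i) (π ⟨$⟩ˡ j) (trans (sym (mem-relabel π G i j)) h)

restrict-inject₁ : ∀ {n} (a : Fin n) → restrict n (inject₁ a) ≡ just a
restrict-inject₁ {n} a with Fin.toℕ (inject₁ a) ℕP.<? n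
... | yes p  = cong just (FinP.toℕ-injective (trans (FinP.toℕ-fromℕ< p) (FinP.toℕ-inject₁ a)))
... | no  ¬p = ⊥-elim (¬p (FinP.inject₁ℕ< a))

restrict-fromℕ : ∀ n → restrict n (fromℕ n) ≡ nothing
restrict-fromℕ n with Fin.toℕ (fromℕ n) ℕP.<? n
... | yes p = ⊥-elim (ℕP.<-irrefl (FinP.toℕ-fromℕ n) p)
... | no _  = refl

embedAdj : ∀ {m n} → EdgeSet m → Fin n → Fin n → Bool
embedAdj {m} H i j with restrict m i | restrict m j
... | just a | just b = mem H a b
... | _      | _      = false

mem-embed : ∀ {m n} (H : EdgeSet m) (i j : Fin n) → mem (embed H) i j ≡ embedAdj H i j
mem-embed {m} H = mem-determined (embed H) (embedAdj H) adj-sym adj-irrefl adj-edge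
  where
  adj-sym : ∀ i j → embedAdj H i j ≡ embedAdj H j i
  adj-sym i j with restrict m i | restrict m j
  ... | just a  | just b  = mem-sym H a b
  ... | just _  | nothing = refl
  ... | nothing | just _  = refl
  ... | nothing | nothing = refl
  adj-irrefl : ∀ i → embedAdj H i i ≡ false
  adj-irrefl i with restrict m i
  ... | just a  = mem-irrefl H a
  ... | nothing = refl
  adj-edge : ∀ i j i<j → embed H (i , j , i<j) ≡ embedAdj H i j
  adj-edge i j _ with restrict m i | restrict m j
  ... | just _  | just _  = refl
  ... | just _  | nothing = refl
  ... | nothing | _       = refl

mem-embed-inject₁ : ∀ {n} (H : EdgeSet n) a b →
                    mem (embed {n} {suc n} H) (inject₁ a) (inject₁ b) ≡ mem H a b
mem-embed-inject₁ H a b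
  rewrite mem-embed H (inject₁ a) (inject₁ b) | restrict-inject₁ a | restrict-inject₁ b = refl

mem-embed-fromℕ : ∀ {n} (H : EdgeSet n) j → mem (embed {n} {suc n} H) (fromℕ n) j ≡ false
mem-embed-fromℕ {n} H j rewrite mem-embed H (fromℕ n) j | restrict-fromℕ n = refl

sum-last-zero : ∀ {n} (f : Fin (suc n) → ℕ) → f (fromℕ n) ≡ 0 → sum f ≡ sum (f ∘ inject₁)
sum-last-zero f f-last =
  trans (sum-init-last f) (trans (cong (sum (f ∘ inject₁) +_) f-last) (ℕP.+-identityʳ _))

size-embed : ∀ {n} (H : EdgeSet n) → size (embed {n} {suc n} H) ≡ size H
size-embed {n} H = ℕP.*-cancelˡ-≡ _ _ 2 (begin
  2 * size E
    ≡⟨ sym (handshake E) ⟩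
  ∑[ i < suc n ] ∑[ j < suc n ] 𝟙 (mem E i j)
    ≡⟨ sum-last-zero (λ i → ∑[ j < suc n ] 𝟙 (mem E i j)) last-row ⟩
  ∑[ a < n ] ∑[ j < suc n ] 𝟙 (mem E (inject₁ a) j)
    ≡⟨ sum-cong-≗ (λ a → sum-last-zero (𝟙 ∘ mem E (inject₁ a)) (last-column a)) ⟩
  ∑[ a < n ] ∑[ b < n ] 𝟙 (mem E (inject₁ a) (inject₁ b))
    ≡⟨ sum-cong-≗ (λ a → sum-cong-≗ (cong 𝟙 ∘ mem-embed-inject₁ H a)) ⟩
  ∑[ a < n ] ∑[ b < n ] 𝟙 (mem H a b)
    ≡⟨ handshake H ⟩
  2 * size H
    ∎)
  where
  open ≡-Reasoning
  E = embed {n} {suc n} H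
  last-row : ∑[ j < suc n ] 𝟙 (mem E (fromℕ n) j) ≡ 0
  last-row = trans (sum-cong-≗ (cong 𝟙 ∘ mem-embed-fromℕ H)) (sum-replicate-zero (suc n))
  last-column : ∀ a → 𝟙 (mem E (inject₁ a) (fromℕ n)) ≡ 0
  last-column a = cong 𝟙 (trans (mem-sym E (inject₁ a) (fromℕ n)) (mem-embed-fromℕ H (inject₁ a)))

unembed : ∀ {n} → EdgeSet (suc n) → EdgeSet n
unembed G (a , b , _) = mem G (inject₁ a) (inject₁ b)

mem-unembed : ∀ {n} (G : EdgeSet (suc n)) a b → mem (unembed G) a b ≡ mem G (inject₁ a) (inject₁ b)
mem-unembed G = mem-determined (unembed G) (λ a b → mem G (inject₁ a) (inject₁ b))
  (λ a b → mem-sym G (inject₁ a) (inject₁ b)) (λ a → mem-irrefl G (inject₁ a)) (λ a b a<b → refl)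

embed-unembed : ∀ {n} (G : EdgeSet (suc n)) → (∀ j → mem G (fromℕ n) j ≡ false) →
                G ≐ embed (unembed G)
embed-unembed {n} G last-isolated = ≐-from-mem adjacency
  where
  E = embed {n} {suc n} (unembed G)
  adjacency : ∀ i j → mem G i j ≡ mem E i j
  adjacency i j with view i | view j
  ... | ‵fromℕ | _ = trans (last-isolated j) (sym (mem-embed-fromℕ (unembed G) j))
  ... | ‵inj₁ {i = a} _ | ‵fromℕ = begin
    mem G (inject₁ a) (fromℕ n) ≡⟨ mem-sym G (inject₁ a) (fromℕ n) ⟩
    mem G (fromℕ n) (inject₁ a) ≡⟨ last-isolated (inject₁ a) ⟩
    false                       ≡⟨ sym (mem-embed-fromℕ (unembed G) (inject₁ a)) ⟩
    mem E (fromℕ n) (inject₁ a) ≡⟨ mem-sym E (fromℕ n) (inject₁ a) ⟩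
    mem E (inject₁ a) (fromℕ n) ∎
    where open ≡-Reasoning
  ... | ‵inj₁ {i = a} _ | ‵inj₁ {i = b} _ =
    sym (trans (mem-embed-inject₁ (unembed G) a b) (mem-unembed G a b))

record Extension {n} (M : Matroid n) (S : VSet n) (I : EdgeSet n) (m : ℕ) : Set where
  field
    base   : EdgeSet n
    indep  : Indep M base
    within : Within S base
    ⊇I     : I ⊆ base
    size≡  : size base ≡ m

extend-within : ∀ {n} (M : Matroid n) {S : VSet n} {J I} → Indep M J → Within S J →
                Indep M I → Within S I → size I ≤ size J → Extension M S I (size J)
extend-within M {S} {J} {I} indJ J⊆S indI I⊆S I≤J =
  go (size J ∸ size I) indI I⊆S (ℕP.m+[n∸m]≡n I≤J)
  where
  go : ∀ t {I} → Indep M I → Within S I → size I + t ≡ size J → Extension M S I (size J)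
  go zero {I} indI I⊆S I≡J = record
    { base = I ; indep = indI ; within = I⊆S ; ⊇I = λ _ h → h
    ; size≡ = trans (sym (ℕP.+-identityʳ _)) I≡J }
  go (suc t) {I} indI I⊆S I+t≡J
    with augment M indI indJ (subst (size I <_) I+t≡J (ℕP.m<m+n (size I) (s≤s z≤n)))
  ... | (i , j , i<j) , Je , Ie , indI+e = record
    { base = base ; indep = indep ; within = within ; size≡ = size≡
    ; ⊇I = λ e′ → ⊇I e′ ∘ ⊆-insert I (i , j , i<j) e′ }
    where
    Sij = within-edge J⊆S i<j Je
    I+e+t≡J : size (insert (i , j , i<j) I) + t ≡ size J
    I+e+t≡J = trans (cong (_+ t) (size-insert I (i , j , i<j) Ie)) (trans (sym (ℕP.+-suc (size I) t)) I+t≡J)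
    open Extension (go t indI+e (within-insert i<j I⊆S (proj₁ Sij) (proj₂ Sij)) I+e+t≡J)

record DoubleAugmentation {n} (M : Matroid n) (B : EdgeSet n) : Set where
  field
    e₁ e₂   : Edge n
    e₁∉B    : B e₁ ≡ false
    e₂∉B+e₁ : insert e₁ B e₂ ≡ false
    indep   : Indep M (insert e₂ (insert e₁ B))

augment-twice : ∀ {n} (M : Matroid n) {B T : EdgeSet n} → Indep M B → Indep M T →
                size T ≡ 2 + size B → DoubleAugmentation M B
augment-twice M {B} {T} indB indT T≡2+B
  with augment M indB indT (subst (size B <_) (sym T≡2+B) (ℕP.m<n+m (size B) {2} (s≤s z≤n)))
... | e₁ , _ , Be₁ , indB+e₁
  with augment M indB+e₁ indT (subst₂ _<_ (sym (size-insert B e₁ Be₁)) (sym T≡2+B) ℕP.≤-refl)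
...   | e₂ , _ , B+e₁∌e₂ , indB+e₁+e₂ = record
  { e₁ = e₁ ; e₂ = e₂ ; e₁∉B = Be₁ ; e₂∉B+e₁ = B+e₁∌e₂ ; indep = indB+e₁+e₂ }

augment-forced : ∀ {n} (M : Matroid n) {I X : EdgeSet n} {e} → Indep M I → Indep M X →
                 size I < size X → (∀ f → X f ≡ true → I f ≡ false → Indep M (insert f I) → f ≡ e) →
                 Indep M (insert e I)
augment-forced M indI indX I<X forced with augment M indI indX I<X
... | f , Xf , If , indI+f with forced f Xf If indI+f
...   | refl = indI+f

rank : ℕ → ℕ
rank n = 2 * n ∸ 3

rank-2+ : ∀ k → rank (2 + k) ≡ suc (2 * k)
rank-2+ k = cong (_∸ 3) (ℕP.*-distribˡ-+ 2 2 k)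

rank-suc : ∀ k → rank (3 + k) ≡ 2 + rank (2 + k)
rank-suc k = begin
  rank (3 + k)     ≡⟨ rank-2+ (suc k) ⟩
  suc (2 * suc k)  ≡⟨ cong suc (ℕP.*-suc 2 k) ⟩
  2 + suc (2 * k)  ≡⟨ cong (2 +_) (sym (rank-2+ k)) ⟩
  2 + rank (2 + k) ∎
  where open ≡-Reasoning

≤rank⇒+3≤ : ∀ k {m} → m ≤ rank (2 + k) → m + 3 ≤ 2 * (2 + k)
≤rank⇒+3≤ k {m} m≤r = subst (m + 3 ≤_) (ℕP.m∸n+n≡m 3≤) (ℕP.+-monoˡ-≤ 3 m≤r)
  where
  3≤ : 3 ≤ 2 * (2 + k)
  3≤ = ℕP.≤-trans (ℕP.n≤1+n 3) (ℕP.*-monoʳ-≤ 2 (s≤s (s≤s (z≤n {k}))))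

+3≤⇒≤rank : ∀ n {m} → m + 3 ≤ 2 * n → m ≤ rank n
+3≤⇒≤rank n {m} = ℕP.m+n≤o⇒m≤o∸n m

-- Independent graphs are R-independent

full-or-missing : ∀ {n} (S : VSet n) → (∀ i → S i ≡ true) ⊎ ∃ λ w → S w ≡ false
full-or-missing S with FinP.all? (λ i → S i 𝔹.≟ true)
... | yes full = inj₁ full
... | no ¬full with FinP.¬∀⟶∃¬ _ _ (λ i → S i 𝔹.≟ true) ¬full
...   | w , Sw≢true = inj₂ (w , 𝔹.¬-not Sw≢true)

module _ (F : RigidityFamily) where

  drop-vertex : ∀ k {G : EdgeSet (3 + k)} {S w} → Indep (M F (suc k)) G → Within S G → S w ≡ false →
                Σ (EdgeSet (2 + k)) λ H →
                  Indep (M F k) H × Within (λ a → S (toLast w ⟨$⟩ˡ inject₁ a)) H × size H ≡ size G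
  drop-vertex k {G} {S} {w} indG G⊆S Sw = H , indH , H⊆S′ , size-H
    where
    τ = toLast w
    G′ = relabel τ G
    H = unembed G′
    last-isolated : ∀ j → mem G′ (fromℕ (2 + k)) j ≡ false
    last-isolated j = 𝔹.¬-not λ h →
      𝔹.not-¬ Sw (subst (λ u → S u ≡ true) (toLast-last w) (within-relabel τ G⊆S _ j h))
    G′≐ : G′ ≐ embed H
    G′≐ = embed-unembed G′ last-isolated
    indH : Indep (M F k) H
    indH = Equivalence.from (compat F k (suc k) (ℕP.n≤1+n k) H)
             (indep-resp (M F (suc k)) G′≐ (relabel-inv F (suc k) τ G indG))
    H⊆S′ : Within (λ a → S (τ ⟨$⟩ˡ inject₁ a)) H
    H⊆S′ a b h = within-relabel τ G⊆S (inject₁ a) (inject₁ b) (trans (sym (mem-unembed G′ a b)) h)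
    size-H : size H ≡ size G
    size-H = trans (sym (size-embed H)) (trans (sym (size-cong G′≐)) (size-relabel τ G))

  within-size-bound : ∀ k {G : EdgeSet (2 + k)} {S} → Indep (M F k) G → Within S G →
                      2 ≤ count S → size G + 3 ≤ 2 * count S
  within-size-bound k {G} {S} indG G⊆S 2≤∣S∣ with full-or-missing S
  ... | inj₁ full = subst (λ m → size G + 3 ≤ 2 * m) (sym ∣S∣≡) (≤rank⇒+3≤ k (rank-bound F k G indG))
    where
    ∣S∣≡ : count S ≡ 2 + k
    ∣S∣≡ = trans (sum-cong-≗ {x = λ i → 𝟙 (S i)} {λ _ → 1} (cong 𝟙 ∘ full)) (count-all (2 + k))
  within-size-bound zero {S = S} _ _ 2≤∣S∣ | inj₂ (w , Sw) =
    ⊥-elim (ℕP.<-irrefl refl (ℕP.≤-trans 2≤∣S∣ (subst (_≤ 1) (sym (count-missing S Sw)) (count≤n S′))))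
    where
    S′ : Fin 1 → Bool
    S′ a = S (toLast w ⟨$⟩ˡ inject₁ a)
  within-size-bound (suc k) {G} {S} indG G⊆S 2≤∣S∣ | inj₂ (w , Sw) =
    let H , indH , H⊆S′ , size-H = drop-vertex k indG G⊆S Sw
    in subst₂ (λ a b → a + 3 ≤ 2 * b) size-H (sym ∣S∣≡)
         (within-size-bound k {H} {S′} indH H⊆S′ (subst (2 ≤_) ∣S∣≡ 2≤∣S∣))
    where
    S′ : VSet (2 + k)
    S′ a = S (toLast w ⟨$⟩ˡ inject₁ a)
    ∣S∣≡ : count S ≡ count S′
    ∣S∣≡ = count-missing S Sw

  indep⇒RIndep : ∀ {k} {G : EdgeSet (2 + k)} → Indep (M F k) G → RIndep G
  indep⇒RIndep {k} {G} indG S 2≤∣S∣ =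
    subst (λ m → size (G ↾ S) + 3 ≤ 2 * m) (sym (countL-allFin S))
      (within-size-bound k (indep-⊆ (M F k) (↾-⊆ G S) indG) (↾-within G S)
        (subst (2 ≤_) (countL-allFin S) 2≤∣S∣))

-- Vertices of degree at most two

module _ (F : RigidityFamily) {k : ℕ} (v : Fin (3 + k)) where

  avoiding-size-bound : ∀ {I} → Indep (M F (suc k)) I → Within (others v) I → size I ≤ rank (2 + k)
  avoiding-size-bound {I} indI I⊆U = +3≤⇒≤rank (2 + k)
    (subst (λ m → size I + 3 ≤ 2 * m) (count-others v) (within-size-bound F (suc k) indI I⊆U 2≤∣U∣))
    where
    2≤∣U∣ : 2 ≤ count (others v)
    2≤∣U∣ = subst (2 ≤_) (sym (count-others v)) (s≤s (s≤s z≤n))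

  avoiding-base : Σ (EdgeSet (3 + k)) λ J →
                    Indep (M F (suc k)) J × Within (others v) J × size J ≡ rank (2 + k)
  avoiding-base with rank-attained F k
  ... | J₀ , indJ₀ , size-J₀ = relabel τ (embed J₀) , indJ , J⊆U , size-J
    where
    τ = toLast v
    indJ : Indep (M F (suc k)) (relabel τ (embed J₀))
    indJ = relabel-inv F (suc k) τ (embed J₀)
             (Equivalence.to (compat F k (suc k) (ℕP.n≤1+n k) J₀) indJ₀)
    J⊆U : Within (others v) (relabel τ (embed J₀))
    J⊆U i j h = ≢-others {v = v} {i} λ { refl → 𝔹.not-¬ (mem-embed-fromℕ J₀ (τ ⟨$⟩ˡ j))
      (subst (λ u → mem (embed J₀) u (τ ⟨$⟩ˡ j) ≡ true) (toLast-self v)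
        (trans (sym (mem-relabel τ (embed J₀) v j)) h)) }
    size-J : size (relabel τ (embed J₀)) ≡ rank (2 + k)
    size-J = trans (size-relabel τ (embed J₀)) (trans (size-embed J₀) size-J₀)

  augment-touches : ∀ {B f} → Within (others v) B → size B ≡ rank (2 + k) → B f ≡ false →
                    Indep (M F (suc k)) (insert f B) → ∃ λ a → Joins f v a
  augment-touches {B} {i , j , i<j} B⊆U size-B Bf indB+f with i ≟ v | j ≟ v
  ... | yes refl | _        = j , forward i<j
  ... | no _     | yes refl = i , backward i<j
  ... | no i≢v   | no j≢v   = ⊥-elim (ℕP.<-irrefl refl
    (subst (_≤ rank (2 + k)) (trans (size-insert B (i , j , i<j) Bf) (cong suc size-B))
      (avoiding-size-bound indB+f
        (within-insert i<j B⊆U (≢-others {v = v} {i} i≢v) (≢-others {v = v} {j} j≢v)))))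

module LowDegreeVertex
  (F : RigidityFamily) {k : ℕ} {C : EdgeSet (3 + k)} (circ : IsCircuit (M F (suc k)) C)
  {v x y : Fin (3 + k)} (x≢y : x ≢ y) (x≢v : x ≢ v) (y≢v : y ≢ v)
  (Cvx : mem C v x ≡ true) (N⊆xy : ∀ z → mem C v z ≡ true → z ≡ x ⊎ z ≡ y)
  where

  private
    MK = M F (suc k)
    U  = others v

  vx vy : Edge (3 + k)
  vx = proj₁ (edgeBetween (x≢v ∘ sym))
  vy = proj₁ (edgeBetween (y≢v ∘ sym))

  vx-joins : Joins vx v x
  vx-joins = proj₂ (edgeBetween (x≢v ∘ sym))

  vy-joins : Joins vy v y
  vy-joins = proj₂ (edgeBetween (y≢v ∘ sym))

  G : EdgeSet (3 + k)
  G = C ↾ U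

  G⊂C : G ⊂ C
  G⊂C = ↾-⊆ C U , vx , trans (sym (joins-mem C vx-joins)) Cvx , within-others-joins (↾-within C U) vx-joins

  indG : Indep MK G
  indG = proj₂ circ G G⊂C

  -- Opaque: unfolding the extension during unification is prohibitively expensive.
  opaque
    extension : Extension MK U G (rank (2 + k))
    extension =
      let J , indJ , J⊆U , size-J = avoiding-base F v
          G≤J = subst (size G ≤_) (sym size-J) (avoiding-size-bound F v {G} indG (↾-within C U))
      in subst (Extension MK U G) size-J (extend-within MK {U} {J} {G} indJ J⊆U indG (↾-within C U) G≤J)

  open Extension extension
    renaming (base to B; indep to indB; within to B⊆U; ⊇I to G⊆B; size≡ to size-B)

  T-base : Σ (EdgeSet (3 + k)) λ T → Indep MK T × size T ≡ rank (3 + k)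
  T-base = rank-attained F (suc k)

  size-T : size (proj₁ T-base) ≡ 2 + size B
  size-T = trans (proj₂ (proj₂ T-base)) (trans (rank-suc k) (cong (2 +_) (sym size-B)))

  open DoubleAugmentation (augment-twice MK indB (proj₁ (proj₂ T-base)) size-T) renaming (indep to indP)

  P : EdgeSet (3 + k)
  P = insert e₂ (insert e₁ B)

  touch₁ : ∃ λ a → Joins e₁ v a
  touch₁ = augment-touches F v {B} {e₁} B⊆U size-B e₁∉B
             (indep-⊆ MK {P} {insert e₁ B} (⊆-insert (insert e₁ B) e₂) indP)

  touch₂ : ∃ λ a → Joins e₂ v a
  touch₂ = augment-touches F v {B} {e₂} B⊆U size-B
             (⊆-false {X = B} {insert e₁ B} (⊆-insert B e₁) {e₂} e₂∉B+e₁)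
             (indep-⊆ MK {P} {insert e₂ B} (insert-mono e₂ (⊆-insert B e₁)) indP)

  a₁ a₂ : Fin (3 + k)
  a₁ = proj₁ touch₁
  a₂ = proj₁ touch₂

  a₁≢a₂ : a₁ ≢ a₂
  a₁≢a₂ eq = 𝔹.not-¬ e₂∉B+e₁ (subst (λ e → insert e₁ B e ≡ true)
               (joins-unique (proj₂ touch₁) (subst (Joins e₂ v) (sym eq) (proj₂ touch₂))) (∈-insert B e₁))

  P-va₁ : mem P v a₁ ≡ true
  P-va₁ = trans (joins-mem P (proj₂ touch₁)) (⊆-insert (insert e₁ B) e₂ e₁ (∈-insert B e₁))

  P-va₂ : mem P v a₂ ≡ true
  P-va₂ = trans (joins-mem P (proj₂ touch₂)) (∈-insert (insert e₁ B) e₂)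

  σ-data : Σ (Permutation′ (3 + k)) λ σ → σ ⟨$⟩ˡ v ≡ v × σ ⟨$⟩ˡ x ≡ a₁ × σ ⟨$⟩ˡ y ≡ a₂
  σ-data = permutation-fixing x≢y a₁≢a₂ x≢v y≢v
             (joins-≢ (proj₂ touch₁) ∘ sym) (joins-≢ (proj₂ touch₂) ∘ sym)

  σ : Permutation′ (3 + k)
  σ = proj₁ σ-data

  σ-v : σ ⟨$⟩ˡ v ≡ v
  σ-v = proj₁ (proj₂ σ-data)

  σ-x : σ ⟨$⟩ˡ x ≡ a₁
  σ-x = proj₁ (proj₂ (proj₂ σ-data))

  σ-y : σ ⟨$⟩ˡ y ≡ a₂
  σ-y = proj₂ (proj₂ (proj₂ σ-data))

  B′ P′ X₁ X₂ : EdgeSet (3 + k)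
  B′ = relabel σ B
  P′ = relabel σ P
  X₁ = insert vx B′
  X₂ = insert vy X₁

  B′⊆U : Within U B′
  B′⊆U i j h = ≢-others {v = v} {i} λ i≡v →
    others-≢ (within-relabel σ B⊆U i j h) (trans (cong (σ ⟨$⟩ˡ_) i≡v) σ-v)

  B′∌ : ∀ {e a} → Joins e v a → B′ e ≡ false
  B′∌ = within-others-joins B′⊆U

  P′-vx : P′ vx ≡ true
  P′-vx = trans (relabel-joins σ P vx-joins) (trans (cong₂ (mem P) σ-v σ-x) P-va₁)

  P′-vy : P′ vy ≡ true
  P′-vy = trans (relabel-joins σ P vy-joins) (trans (cong₂ (mem P) σ-v σ-y) P-va₂)

  X₁⊆P′ : X₁ ⊆ P′
  X₁⊆P′ = insert-⊆ {I = B′} {P′} {vx} (relabel-mono σ B⊆P) P′-vx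
    where
    B⊆P : B ⊆ P
    B⊆P e = ⊆-insert (insert e₁ B) e₂ e ∘ ⊆-insert B e₁ e

  indP′ : Indep MK P′
  indP′ = relabel-inv F (suc k) σ P indP

  vy≢vx : vy ≢ vx
  vy≢vx eq = x≢y (joins-other vx-joins (subst (λ e → Joins e v y) eq vy-joins))

  size-X₁ : size X₁ ≡ suc (size B)
  size-X₁ = trans (size-insert B′ vx (B′∌ vx-joins)) (cong suc (size-relabel σ B))

  size-X₂ : size X₂ ≡ suc (size (insert vx B))
  size-X₂ = begin
    size X₂                  ≡⟨ size-insert X₁ vy (∉-insert {I = B′} (B′∌ vy-joins) vy≢vx) ⟩
    suc (size X₁)            ≡⟨ cong suc size-X₁ ⟩
    suc (suc (size B))       ≡⟨ cong suc (sym (size-insert B vx (within-others-joins B⊆U vx-joins))) ⟩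
    suc (size (insert vx B)) ∎
    where open ≡-Reasoning

  indB+vx : Indep MK (insert vx B)
  indB+vx = augment-forced MK {B} {X₁} {vx} indB (indep-⊆ MK {P′} {X₁} X₁⊆P′ indP′)
              (subst (size B <_) (sym size-X₁) ℕP.≤-refl) forced
    where
    forced : ∀ f → X₁ f ≡ true → B f ≡ false → Indep MK (insert f B) → f ≡ vx
    forced f X₁f Bf indB+f = [ in-B′ , id ]′ (insert-cases {I = B′} {vx} X₁f)
      where
      touches : ∃ λ a → Joins f v a
      touches = augment-touches F v {B} {f} B⊆U size-B Bf indB+f
      in-B′ : B′ f ≡ true → f ≡ vx
      in-B′ = ⊥-elim ∘ 𝔹.not-¬ (B′∌ (proj₂ touches))

  indB+vx+vy : Indep MK (insert vy (insert vx B))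
  indB+vx+vy = augment-forced MK {insert vx B} {X₂} {vy} indB+vx
                 (indep-⊆ MK {P′} {X₂} (insert-⊆ {I = X₁} {P′} {vy} X₁⊆P′ P′-vy) indP′)
                 (subst (size (insert vx B) <_) (sym size-X₂) ℕP.≤-refl) forced
    where
    forced : ∀ f → X₂ f ≡ true → insert vx B f ≡ false → Indep MK (insert f (insert vx B)) → f ≡ vy
    forced f X₂f B+vx∌f indB+vx+f =
      [ (λ X₁f → ⊥-elim ([ ∉B′ , ≢vx ]′ (insert-cases {I = B′} {vx} X₁f))) , id ]′
        (insert-cases {I = X₁} {vy} X₂f)
      where
      ≢vx : f ≢ vx
      ≢vx f≡vx = 𝔹.not-¬ B+vx∌f (subst (λ e → insert vx B e ≡ true) (sym f≡vx) (∈-insert B vx))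
      touches : ∃ λ a → Joins f v a
      touches = augment-touches F v {B} {f} B⊆U size-B
                  (⊆-false {X = B} {insert vx B} (⊆-insert B vx) {f} B+vx∌f)
                  (indep-⊆ MK {insert f (insert vx B)} {insert f B} (insert-mono f (⊆-insert B vx)) indB+vx+f)
      ∉B′ : B′ f ≢ true
      ∉B′ = 𝔹.not-¬ (B′∌ (proj₂ touches))

  C⊆B+vx+vy : C ⊆ insert vy (insert vx B)
  C⊆B+vx+vy e Ce = [ in-G , at-v ]′ (↾-others-or-joins C v e Ce)
    where
    B+vx+vy = insert vy (insert vx B)
    in-G : G e ≡ true → B+vx+vy e ≡ true
    in-G Ge = ⊆-insert (insert vx B) vy e (⊆-insert B vx e (G⊆B e Ge))
    at-v : (∃ λ a → Joins e v a) → B+vx+vy e ≡ true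
    at-v (a , e-va) = [ is-vx , is-vy ]′ (N⊆xy a (trans (joins-mem C e-va) Ce))
      where
      is-vx : a ≡ x → B+vx+vy e ≡ true
      is-vx refl = subst (λ f → B+vx+vy f ≡ true) (joins-unique vx-joins e-va)
                     (⊆-insert (insert vx B) vy vx (∈-insert B vx))
      is-vy : a ≡ y → B+vx+vy e ≡ true
      is-vy refl = subst (λ f → B+vx+vy f ≡ true) (joins-unique vy-joins e-va) (∈-insert (insert vx B) vy)

  impossible : ⊥
  impossible = proj₁ circ (indep-⊆ MK {insert vy (insert vx B)} {C} C⊆B+vx+vy indB+vx+vy)

third-vertex : ∀ {n} {v x : Fin (3 + n)} → x ≢ v → Σ (Fin (3 + n)) λ y → x ≢ y × y ≢ v
third-vertex {v = v} {x} x≢v = punchIn v y′ , x≢y , FinP.punchInᵢ≢i v y′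
  where
  x′ = punchOut (x≢v ∘ sym)
  y′ = punchIn x′ 0F
  x≢y : x ≢ punchIn v y′
  x≢y eq = FinP.punchInᵢ≢i x′ 0F
             (sym (FinP.punchIn-injective v x′ y′ (trans (FinP.punchIn-punchOut (x≢v ∘ sym)) eq)))

cover-by-two : ∀ {n} (f : Fin (3 + n) → Bool) {v x} → f v ≡ false → f x ≡ true → count f ≤ 2 →
               Σ (Fin (3 + n)) λ y → x ≢ y × y ≢ v × ∀ z → f z ≡ true → z ≡ x ⊎ z ≡ y
cover-by-two f {v} {x} fv fx count≤2 with FinP.any? (λ y → ¬? (x ≟ y) ×-dec (f y 𝔹.≟ true))
... | yes (y , x≢y , fy) = y , x≢y , (λ { refl → 𝔹.not-¬ fv fy }) , covers
  where
  covers : ∀ z → f z ≡ true → z ≡ x ⊎ z ≡ y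
  covers z fz with z ≟ x | z ≟ y
  ... | yes z≡x | _       = inj₁ z≡x
  ... | no _    | yes z≡y = inj₂ z≡y
  ... | no z≢x  | no z≢y  =
    ⊥-elim (ℕP.<-irrefl refl (ℕP.≤-trans (count≥3 f x≢y (z≢x ∘ sym) (z≢y ∘ sym) fx fy fz) count≤2))
... | no ¬other = y , x≢y , y≢v , covers
  where
  x≢v : x ≢ v
  x≢v refl = 𝔹.not-¬ fv fx
  y = proj₁ (third-vertex x≢v)
  x≢y = proj₁ (proj₂ (third-vertex x≢v))
  y≢v = proj₂ (proj₂ (third-vertex x≢v))
  covers : ∀ z → f z ≡ true → z ≡ x ⊎ z ≡ y
  covers z fz with z ≟ x
  ... | yes z≡x = inj₁ z≡x
  ... | no z≢x  = ⊥-elim (¬other (z , z≢x ∘ sym , fz))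

circuit-min-degree : ∀ (F : RigidityFamily) k {C : EdgeSet (3 + k)} → IsCircuit (M F (suc k)) C →
                     ∀ v → 0 < deg C v → 3 ≤ deg C v
circuit-min-degree F k {C} circ v 0<deg with 3 ℕP.≤? deg C v
... | yes 3≤deg = 3≤deg
... | no  3≰deg =
  ⊥-elim (LowDegreeVertex.impossible F circ {v} {x} {y} x≢y (mem-true-≢ C Cvx ∘ sym) y≢v Cvx N⊆xy)
  where
  deg≡ : deg C v ≡ count (mem C v)
  deg≡ = countL-allFin (mem C v)
  neighbour : ∃ λ x → mem C v x ≡ true
  neighbour = count-pos (mem C v) (subst (0 <_) deg≡ 0<deg)
  x = proj₁ neighbour
  Cvx = proj₂ neighbour
  cover : Σ (Fin (3 + k)) λ y → x ≢ y × y ≢ v × ∀ z → mem C v z ≡ true → z ≡ x ⊎ z ≡ y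
  cover = cover-by-two (mem C v) {v} {x} (mem-irrefl C v) Cvx
            (subst (_≤ 2) deg≡ (ℕP.≤-pred (ℕP.≰⇒> 3≰deg)))
  y = proj₁ cover
  x≢y = proj₁ (proj₂ cover)
  y≢v = proj₁ (proj₂ (proj₂ cover))
  N⊆xy = proj₂ (proj₂ (proj₂ cover))

-- Circuits and degrees

K₂-has-no-circuit : ∀ (F : RigidityFamily) (C : EdgeSet 2) → ¬ IsCircuit (M F 0) C
K₂-has-no-circuit F C circ = proj₁ circ (indep-⊆ (M F 0) C⊆T indT)
  where
  e₀ : Edge 2
  e₀ = 0F , 1F , s≤s z≤n
  only-edge : ∀ (e : Edge 2) → e ≡ e₀
  only-edge (0F , 0F , ())
  only-edge (0F , 1F , p) = edge-≡ p (s≤s z≤n)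
  only-edge (1F , 0F , ())
  only-edge (1F , 1F , s≤s ())
  T = proj₁ (rank-attained F 0)
  indT = proj₁ (proj₂ (rank-attained F 0))
  𝟙≡1 : ∀ {b} → 𝟙 b + 0 ≡ 1 → b ≡ true
  𝟙≡1 {true} _ = refl
  T-e₀ : T e₀ ≡ true
  T-e₀ = 𝟙≡1 (trans (sym (size-cong {G = T} {λ _ → T e₀} (cong T ∘ only-edge)))
                     (proj₂ (proj₂ (rank-attained F 0))))
  C⊆T : C ⊆ T
  C⊆T e _ = trans (cong T (only-edge e)) T-e₀

circuit-has-edge : ∀ {n} (M : Matroid n) {C} → IsCircuit M C → ∃₂ λ i j → mem C i j ≡ true
circuit-has-edge M {C} circ with FinP.any? (λ i → FinP.any? (λ j → mem C i j 𝔹.≟ true))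
... | yes (i , j , Cij) = i , j , Cij
... | no none = ⊥-elim (proj₁ circ (indep-resp M ∅≐C (indep-∅ M)))
  where
  ∅≐C : ∅ ≐ C
  ∅≐C (i , j , i<j) = sym (trans (sym (mem-edge C i<j)) (𝔹.¬-not λ Cij → none (i , j , Cij)))

circuit-RIndep : ∀ (F : RigidityFamily) {k} {C : EdgeSet (2 + k)} → IsCircuit (M F k) C →
                 ¬ RCircuit C → RIndep C
circuit-RIndep F {C = C} circ ¬RC S 2≤∣S∣ with induced C S + 3 ℕP.≤? 2 * vcount S
... | yes bound = bound
... | no ¬bound =
  ⊥-elim (¬RC ((λ RC → ¬bound (RC S 2≤∣S∣)) , λ D D⊂C → indep⇒RIndep F (proj₂ circ D D⊂C)))

nonIsolated : ∀ {n} → EdgeSet n → VSet n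
nonIsolated G v = 0 <ᵇ deg G v

within-nonIsolated : ∀ {n} (G : EdgeSet n) → Within (nonIsolated G) G
within-nonIsolated G a b Gab =
  0<⇒0<ᵇ (subst (1 ≤_) (sym (countL-allFin (mem G a))) (count≥1 (mem G a) {b} Gab))
  where
  0<⇒0<ᵇ : ∀ {d} → 0 < d → (0 <ᵇ d) ≡ true
  0<⇒0<ᵇ {suc d} _ = refl

RIndep⇒size-bound : ∀ {n} (G : EdgeSet n) → RIndep G → ∀ {i j} → mem G i j ≡ true →
                    size G + 3 ≤ 2 * nVerts G
RIndep⇒size-bound G indG {i} {j} Gij =
  subst (λ m → m + 3 ≤ 2 * nVerts G) (↾-within-size (within-nonIsolated G))
    (indG (nonIsolated G) 2≤nVerts)
  where
  2≤nVerts : 2 ≤ vcount (nonIsolated G)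
  2≤nVerts = subst (2 ≤_) (sym (countL-allFin (nonIsolated G)))
    (count≥2 (nonIsolated G) {i} {j} (mem-true-≢ G Gij) (within-nonIsolated G i j Gij)
      (within-nonIsolated G j i (trans (mem-sym G j i) Gij)))

four-per-vertex : ∀ d → (0 < d → 3 ≤ d) → 4 * 𝟙 (0 <ᵇ d) ≤ d + 𝟙 (d ≡ᵇ 3)
four-per-vertex 0 _ = z≤n
four-per-vertex 1 min-deg with min-deg (s≤s z≤n)
... | s≤s ()
four-per-vertex 2 min-deg with min-deg (s≤s z≤n)
... | s≤s (s≤s ())
four-per-vertex 3 _ = ℕP.≤-refl
four-per-vertex (suc (suc (suc (suc d)))) _ = s≤s (s≤s (s≤s (s≤s z≤n)))

six-of-degree-three : ∀ {n} (G : EdgeSet n) → (∀ v → 0 < deg G v → 3 ≤ deg G v) →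
                      size G + 3 ≤ 2 * nVerts G → 6 ≤ nDeg3 G
six-of-degree-three {n} G min-deg bound =
  ℕP.+-cancelˡ-≤ (2 * size G) 6 (nDeg3 G) (ℕP.≤-trans lower upper)
  where
  lower : 2 * size G + 6 ≤ 4 * nVerts G
  lower = subst₂ _≤_ (ℕP.*-distribˡ-+ 2 (size G) 3) (sym (ℕP.*-assoc 2 2 (nVerts G)))
            (ℕP.*-monoʳ-≤ 2 bound)
  upper : 4 * nVerts G ≤ 2 * size G + nDeg3 G
  upper = begin
    4 * nVerts G
      ≡⟨ cong (4 *_) (countL-allFin (nonIsolated G)) ⟩
    4 * count (nonIsolated G)
      ≡⟨ *-distribˡ-sum 4 (λ v → 𝟙 (nonIsolated G v)) ⟩
    sum (λ v → 4 * 𝟙 (0 <ᵇ deg G v))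
      ≤⟨ sum-mono-≤ (λ v → four-per-vertex (deg G v) (min-deg v)) ⟩
    sum (λ v → deg G v + 𝟙 (deg G v ≡ᵇ 3))
      ≡⟨ ∑-distrib-+ (deg G) (λ v → 𝟙 (deg G v ≡ᵇ 3)) ⟩
    sum (deg G) + count (λ v → deg G v ≡ᵇ 3)
      ≡⟨ cong₂ _+_ (∑deg≡2*size G) (sym (countL-allFin (λ v → deg G v ≡ᵇ 3))) ⟩
    2 * size G + nDeg3 G
      ∎
    where open ℕP.≤-Reasoning

lemma4p1 : (F : RigidityFamily) (k : ℕ) (C : EdgeSet (2 + k)) →
    IsCircuit (M F k) C → ¬ RCircuit C →
    RIndep C × (size C + 3 ≤ 2 * nVerts C) × (6 ≤ nDeg3 C)
lemma4p1 F zero    C circ ¬RC = ⊥-elim (K₂-has-no-circuit F C circ)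
lemma4p1 F (suc k) C circ ¬RC =
  indepC , size-bound , six-of-degree-three C (circuit-min-degree F k circ) size-bound
  where
  indepC : RIndep C
  indepC = circuit-RIndep F circ ¬RC
  size-bound : size C + 3 ≤ 2 * nVerts C
  size-bound = let i , j , Cij = circuit-has-edge (M F (suc k)) circ
               in RIndep⇒size-bound C indepC {i} {j} Cij
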